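{- Let $t,\Delta,\omega\ge 2$ be integers and let $a=\lfloor\Delta/(\omega-1)\rfloor$. If $G$ is a graph on $n$ vertices with maximum degree at most $\Delta$, clique number at most $\omega$, and $1\le n\le\Delta+a$, then $\rho_t(G)\le\rho_t\big(T_\omega(\Delta+a)\big)$.
   Context: All graphs are finite and simple. For a graph $G$, $k_t(G)$ denotes the number of copies of $K_t$ in $G$, and $\rho_t(G)=k_t(G)/|V(G)|$. $T_r(n)$ denotes the Turán graph: the complete $r$-partite graph on $n$ vertices whose part sizes differ by at most one. -}

module Defs where

open import Data.Bool using (Bool; true; false; _∧_; _∨_; not; if_then_else_)
open import Data.Nat using (ℕ; zero; suc; _≤_; _/_; _%_; _≡ᵇ_)
open import Data.Nat.Properties using (_≟_)
open import Data.Fin using (Fin; toℕ)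
open import Data.Fin.Subset using (Subset; ∣_∣)
open import Data.Vec using (Vec; []; _∷_; lookup; tabulate)
open import Data.List using (List; []; _∷_; [_]; map; _++_; length; filter; allFin; foldr)
open import Relation.Nullary using (does)
open import Relation.Binary.PropositionalEquality using (_≡_; refl; sym)
import Data.Fin.Properties as FinP

record Graph (n : ℕ) : Set where
  field
    adj    : Fin n → Fin n → Bool
    adj-sym : ∀ i j → adj i j ≡ adj j i
    adj-irr : ∀ i → adj i i ≡ false
open Graph public

degree : ∀ {n} → Graph n → Fin n → ℕ
degree G u = ∣ tabulate (adj G u) ∣

MaxDegreeAtMost : ∀ {n} → Graph n → ℕ → Set
MaxDegreeAtMost G Δ = ∀ u → degree G u ≤ Δ

all : ∀ {A : Set} → (A → Bool) → List A → Bool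
all p = foldr (λ x b → p x ∧ b) true

isCliqueᵇ : ∀ {n} → Graph n → Subset n → Bool
isCliqueᵇ {n} G S =
  all (λ i → all (λ j →
         not (lookup S i ∧ lookup S j ∧ not (does (i FinP.≟ j))) ∨ adj G i j)
       (allFin n)) (allFin n)

IsClique : ∀ {n} → Graph n → Subset n → Set
IsClique G S = isCliqueᵇ G S ≡ true

CliqueNumberAtMost : ∀ {n} → Graph n → ℕ → Set
CliqueNumberAtMost G ω = ∀ S → IsClique G S → ∣ S ∣ ≤ ω

allSubsets : (n : ℕ) → List (Subset n)
allSubsets zero = [ [] ]
allSubsets (suc n) = map (true ∷_) (allSubsets n) ++ map (false ∷_) (allSubsets n)

isKtᵇ : ∀ {n} → Graph n → ℕ → Subset n → Bool
isKtᵇ G t S = (∣ S ∣ ≡ᵇ t) ∧ isCliqueᵇ G S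

k : ∀ {n} → ℕ → Graph n → ℕ
k {n} t G = length (filter (λ S → isKtᵇ G t S Data.Bool.Properties.≟ true) (allSubsets n))
  where import Data.Bool.Properties

-- residue mod r (r = 0 case irrelevant, r ≥ 2 in use)
modℕ : ℕ → ℕ → ℕ
modℕ x zero = x
modℕ x (suc r) = x % suc r

-- Turán graph T_r(N): vertex i lies in part (i mod r); parts have sizes
-- differing by at most one; edges join vertices in different parts.
turanAdj : ℕ → (N : ℕ) → Fin N → Fin N → Bool
turanAdj r N i j = not (does (modℕ (toℕ i) r ≟ modℕ (toℕ j) r))

private
  ≟-sym : ∀ (p q : ℕ) → does (p ≟ q) ≡ does (q ≟ p)
  ≟-sym zero zero = refl
  ≟-sym zero (suc q) = refl
  ≟-sym (suc p) zero = refl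
  ≟-sym (suc p) (suc q) = ≟-sym p q

  ≟-refl : ∀ (p : ℕ) → does (p ≟ p) ≡ true
  ≟-refl zero = refl
  ≟-refl (suc p) = ≟-refl p

Turán : ℕ → (N : ℕ) → Graph N
Turán r N = record
  { adj = turanAdj r N
  ; adj-sym = λ i j → Relation.Binary.PropositionalEquality.cong not (≟-sym (modℕ (toℕ i) r) (modℕ (toℕ j) r))
  ; adj-irr = λ i → Relation.Binary.PropositionalEquality.cong not (≟-refl (modℕ (toℕ i) r))
  }

-- a = ⌊ Δ / (ω - 1) ⌋  (only used for ω ≥ 2)
floorDivPred : ℕ → ℕ → ℕ
floorDivPred Δ zero = 0
floorDivPred Δ (suc zero) = 0
floorDivPred Δ (suc (suc w)) = Δ / suc w

module Submission where

-- By Zykov symmetrisation a K_(ω+1)-free graph on n vertices has at most as many t-cliques as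
-- T_ω(n), namely esym t (balanced ω n). The density esym t (balanced ω N) / N of T_ω(N) is
-- nondecreasing in N: adding a vertex to a smallest part multiplies the count by at least
-- (N+1)/N.

open import Defs
open import Algebra.Bundles using (CommutativeMonoid)
open import Data.Bool using (Bool; true; false; _∧_; _∨_; not)
import Data.Bool.Properties as Bool
open import Data.Fin using (Fin; zero; suc; toℕ)
open import Data.Fin.Subset using (Subset; ∣_∣)
import Data.Fin.Properties as Fin
open import Data.List as List using (List; []; _∷_; _++_; length; filter; allFin; downFrom)
open import Data.List.Membership.Propositional.Properties using (∈-filter⁺; ∈-allFin)
open import Data.List.Relation.Binary.Permutation.Propositional as ↭ using (_↭_; prep; swap)
import Data.List.Relation.Unary.All as All
open import Data.List.Relation.Unary.All.Properties using (all-filter)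
open import Data.Nat
  using (ℕ; zero; suc; _+_; _*_; _∸_; _/_; _%_; _≤_; _<_; _≡ᵇ_; _≤′_; ≤′-reflexive; ≤′-step; z≤n; s≤s; NonZero)
open import Data.Nat.Properties
open import Data.Nat.DivMod
open import Data.Nat.Divisibility using (n∣m*n)
open import Data.Nat.ListAction using (sum)
open import Data.Nat.ListAction.Properties using (sum-↭)
open import Data.Nat.Solver using (module +-*-Solver)
open import Data.Product using (∃; _×_; _,_)
open import Data.Sum using (inj₁; inj₂)
open import Data.Vec as Vec using ([]; _∷_)
open import Data.Vec.Functional using (Vector; head; tail; zipWith)
open import Function using (flip; _∘_; Equivalence)
open import Relation.Binary.Definitions using (Reflexive; Transitive; tri<; tri≈; tri>)
open import Relation.Binary.PropositionalEquality
open import Relation.Nullary using (does; yes; no; contradiction)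
open import Relation.Nullary.Decidable using (dec-true; dec-false)

open import Data.List.Extrema ≤-totalOrder using (argmax; argmax-all; f[xs]≤f[argmax])
open +-*-Solver using (solve; _:+_; _:*_; _:=_; con)
open import Algebra.Properties.CommutativeSemigroup
  (CommutativeMonoid.commutativeSemigroup Bool.∧-commutativeMonoid)
  using () renaming (xy∙z≈xz∙y to ∧-swapʳ)
open import Algebra.Properties.CommutativeSemigroup +-commutativeSemigroup
  using () renaming (interchange to +-interchange; xy∙z≈xz∙y to +-swapʳ; x∙yz≈y∙xz to +-swapˡ)

infixl 7 _∩_
infixl 6 _─_
infix  4 _⊆_

private
  variable
    n : ℕ

when : Bool → ℕ → ℕ
when true  x = x
when false x = 0

when-mono : ∀ {a b x y} → (a ≡ true → b ≡ true) → x ≤ y → when a x ≤ when b y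
when-mono {true}  a⇒b x≤y rewrite a⇒b refl = x≤y
when-mono {false} a⇒b x≤y = z≤n

when-∧ : ∀ a b x → when a (when b x) ≡ when (a ∧ b) x
when-∧ true  b x = refl
when-∧ false b x = refl

when-+ : ∀ a x y → when a (x + y) ≡ when a x + when a y
when-+ true  x y = refl
when-+ false x y = refl

when-comm : ∀ a b x → when a (when b x) ≡ when b (when a x)
when-comm true  b     x = refl
when-comm false true  x = refl
when-comm false false x = refl

VertexSet : ℕ → Set
VertexSet = Vector Bool

private
  variable
    U V : VertexSet n

_∩_ : VertexSet n → VertexSet n → VertexSet n
_∩_ = zipWith _∧_

∁ : VertexSet n → VertexSet n
∁ U i = not (U i)

_─_ : VertexSet n → Fin n → VertexSet n
(U ─ b) i = U i ∧ not (does (i Fin.≟ b))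

_⊆_ : VertexSet n → VertexSet n → Set
U ⊆ V = ∀ i → U i ≡ true → V i ≡ true

∩-monoˡ : ∀ {U V : VertexSet n} W → U ⊆ V → U ∩ W ⊆ V ∩ W
∩-monoˡ {U = U} W U⊆V i p with U i in Ui
... | true = trans (cong (_∧ W i) (U⊆V i Ui)) p

card : VertexSet n → ℕ
card {zero}  U = 0
card {suc n} U = when (head U) 1 + card (tail U)

card-cong : U ≗ V → card U ≡ card V
card-cong {zero}  U≗V = refl
card-cong {suc n} U≗V = cong₂ (λ x y → when x 1 + y) (U≗V zero) (card-cong (λ i → U≗V (suc i)))

card-full : card {n} (λ _ → true) ≡ n
card-full {zero}  = refl
card-full {suc n} = cong suc (card-full {n})

card-zero : ∀ (U : VertexSet n) → card U ≡ 0 → ∀ i → U i ≡ false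
card-zero U ∣U∣≡0 zero with head U
... | false = refl
card-zero U ∣U∣≡0 (suc i) with head U
... | false = card-zero (tail U) ∣U∣≡0 i

card-nonempty : ∀ (U : VertexSet n) {s} → card U ≡ suc s → ∃ λ i → U i ≡ true
card-nonempty {suc n} U ∣U∣≡1+s with head U in U₀
... | true  = zero , U₀
... | false with card-nonempty (tail U) ∣U∣≡1+s
...   | i , Ui = suc i , Ui

card-remove : ∀ (U : VertexSet n) b → U b ≡ true → card U ≡ suc (card (U ─ b))
card-remove U zero U₀ rewrite U₀ =
  cong suc (card-cong (λ i → sym (Bool.∧-identityʳ (U (suc i)))))
card-remove U (suc b) Ub with head U
... | true  = cong suc (card-remove (tail U) b Ub)
... | false = card-remove (tail U) b Ub

card-split : ∀ (U K : VertexSet n) → card U ≡ card (U ∩ K) + card (U ∩ ∁ K)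
card-split {zero}  U K = refl
card-split {suc n} U K with head U | head K
... | true  | true  = cong suc (card-split (tail U) (tail K))
... | true  | false = trans (cong suc (card-split (tail U) (tail K))) (sym (+-suc _ _))
... | false | _     = card-split (tail U) (tail K)

dropFirst : Graph (suc n) → Graph n
dropFirst G = record
  { adj     = λ i j → adj G (suc i) (suc j)
  ; adj-sym = λ i j → adj-sym G (suc i) (suc j)
  ; adj-irr = λ i → adj-irr G (suc i)
  }

cliqueCount : Graph n → ℕ → VertexSet n → ℕ
cliqueCount         G zero    U = 1
cliqueCount {zero}  G (suc t) U = 0
cliqueCount {suc n} G (suc t) U =
  cliqueCount (dropFirst G) (suc t) (tail U)
  + when (head U) (cliqueCount (dropFirst G) t (tail U ∩ tail (adj G zero)))

cliqueCount-cong : ∀ (G : Graph n) t → U ≗ V → cliqueCount G t U ≡ cliqueCount G t V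
cliqueCount-cong         G zero    U≗V = refl
cliqueCount-cong {zero}  G (suc t) U≗V = refl
cliqueCount-cong {suc n} G (suc t) U≗V rewrite U≗V zero =
  cong₂ (λ x y → x + when _ y)
    (cliqueCount-cong (dropFirst G) (suc t) (λ i → U≗V (suc i)))
    (cliqueCount-cong (dropFirst G) t (λ i → cong (_∧ _) (U≗V (suc i))))

cliqueCount-mono : ∀ (G : Graph n) t → U ⊆ V → cliqueCount G t U ≤ cliqueCount G t V
cliqueCount-mono         G zero    U⊆V = ≤-refl
cliqueCount-mono {zero}  G (suc t) U⊆V = ≤-refl
cliqueCount-mono {suc n} G (suc t) U⊆V =
  +-mono-≤ (cliqueCount-mono (dropFirst G) (suc t) (λ i → U⊆V (suc i)))
    (when-mono (U⊆V zero)
      (cliqueCount-mono (dropFirst G) t (∩-monoˡ (tail (adj G zero)) (λ i → U⊆V (suc i)))))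

cliqueCount-empty : ∀ (G : Graph n) t → (∀ i → U i ≡ false) → cliqueCount G (suc t) U ≡ 0
cliqueCount-empty {zero}  G t U≡∅ = refl
cliqueCount-empty {suc n} G t U≡∅ rewrite U≡∅ zero =
  trans (+-identityʳ _) (cliqueCount-empty (dropFirst G) t (λ i → U≡∅ (suc i)))

cliqueCount-one : ∀ (G : Graph n) U → cliqueCount G 1 U ≡ card U
cliqueCount-one {zero}  G U = refl
cliqueCount-one {suc n} G U with head U
... | true  = trans (+-comm _ 1) (cong suc (cliqueCount-one (dropFirst G) (tail U)))
... | false = trans (+-identityʳ _) (cliqueCount-one (dropFirst G) (tail U))

cliqueCount-headAbsent : ∀ (G : Graph (suc n)) t {U} → head U ≡ false →
  cliqueCount G t U ≡ cliqueCount (dropFirst G) t (tail U)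
cliqueCount-headAbsent G zero    U₀≡false = refl
cliqueCount-headAbsent G (suc t) U₀≡false rewrite U₀≡false = +-identityʳ _

cliqueCount-split : ∀ (G : Graph n) b t U →
  cliqueCount G (suc t) U
    ≡ cliqueCount G (suc t) (U ─ b) + when (U b) (cliqueCount G t (U ∩ adj G b))
cliqueCount-split {suc n} G zero t U = cong₂ (λ x y → x + when (U zero) y) avoiding through
  where
    avoiding : cliqueCount (dropFirst G) (suc t) (tail U) ≡ cliqueCount G (suc t) (U ─ zero)
    avoiding = trans (cliqueCount-cong _ (suc t) (λ i → sym (Bool.∧-identityʳ (U (suc i)))))
                     (sym (cliqueCount-headAbsent G (suc t) {U ─ zero} (Bool.∧-zeroʳ (U zero))))
    through : cliqueCount (dropFirst G) t (tail U ∩ tail (adj G zero))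
            ≡ cliqueCount G t (U ∩ adj G zero)
    through = sym (cliqueCount-headAbsent G t {U ∩ adj G zero}
                (trans (cong (U zero ∧_) (adj-irr G zero)) (Bool.∧-zeroʳ (U zero))))
cliqueCount-split {suc n} G (suc b) zero U rewrite Bool.∧-identityʳ (U zero) =
  trans (cong (_+ when (U zero) 1) (cliqueCount-split (dropFirst G) b zero (tail U)))
        (+-swapʳ _ (when (U (suc b)) 1) (when (U zero) 1))
-- Splitting off b commutes with the split off vertex 0 in the definition of cliqueCount.
cliqueCount-split {suc n} G (suc b) (suc t) U = begin
    count (suc (suc t)) U′ + when u (count (suc t) (U′ ∩ N))
  ≡⟨ cong₂ (λ x y → x + when u y) (cliqueCount-split G′ b (suc t) U′)
                                  (cliqueCount-split G′ b t (U′ ∩ N)) ⟩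
    (A + when (U′ b) P) + when u (Z + when (U′ b ∧ N b) Q)
  ≡⟨ cong (λ x → (A + when (U′ b) P) + when u (Z + x)) (sym (when-∧ (U′ b) (N b) Q)) ⟩
    (A + when (U′ b) P) + when u (Z + when (U′ b) (when (N b) Q))
  ≡⟨ rearrange u (U′ b) A P Z (when (N b) Q) ⟩
    (A + when u Z) + when (U′ b) (P + when u (when (N b) Q))
  ≡⟨ cong₂ (λ x y → (A + x) + when (U′ b) (P + y)) avoiding through ⟩
    cliqueCount G (suc (suc t)) (U ─ suc b)
      + when (U (suc b)) (cliqueCount G (suc t) (U ∩ adj G (suc b)))
  ∎
  where
    open ≡-Reasoning
    G′ = dropFirst G
    count = cliqueCount G′
    U′ = tail U
    u = head U
    N = tail (adj G zero)
    A = count (suc (suc t)) (U′ ─ b)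
    Z = count (suc t) (U′ ∩ N ─ b)
    P = count (suc t) (U′ ∩ adj G′ b)
    Q = count t (U′ ∩ N ∩ adj G′ b)

    rearrange : ∀ u s A P Z Q →
      (A + when s P) + when u (Z + when s Q) ≡ (A + when u Z) + when s (P + when u Q)
    rearrange u s A P Z Q = begin
        (A + when s P) + when u (Z + when s Q)
      ≡⟨ cong (_ +_) (trans (when-+ u Z _) (cong (_ +_) (when-comm u s Q))) ⟩
        (A + when s P) + (when u Z + when s (when u Q))
      ≡⟨ +-interchange A _ _ _ ⟩
        (A + when u Z) + (when s P + when s (when u Q))
      ≡⟨ cong (_ +_) (sym (when-+ s P _)) ⟩
        (A + when u Z) + when s (P + when u Q)
      ∎

    avoiding : when u Z ≡ when (u ∧ true) (count (suc t) ((U′ ─ b) ∩ N))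
    avoiding = cong₂ when (sym (Bool.∧-identityʳ u))
                 (cliqueCount-cong G′ (suc t) (λ i → ∧-swapʳ (U′ i) (N i) _))

    through : when u (when (N b) Q)
            ≡ when (u ∧ adj G (suc b) zero) (count t ((U′ ∩ adj G′ b) ∩ N))
    through = trans (when-∧ u (N b) Q)
                (cong₂ (λ x → when (u ∧ x)) (adj-sym G zero (suc b))
                  (cliqueCount-cong G′ t (λ i → ∧-swapʳ (U′ i) (N i) _)))

cliqueCount-neighbourhood : ∀ (G : Graph n) t U b →
  cliqueCount G (suc t) U ≡ 0 → U b ≡ true → cliqueCount G t (U ∩ adj G b) ≡ 0
cliqueCount-neighbourhood G t U b none b∈U =
  m+n≡0⇒n≡0 (cliqueCount G (suc t) (U ─ b)) (begin
    cliqueCount G (suc t) (U ─ b) + cliqueCount G t (U ∩ adj G b)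
  ≡⟨ cong (λ x → cliqueCount G (suc t) (U ─ b) + when x (cliqueCount G t (U ∩ adj G b)))
          (sym b∈U) ⟩
    cliqueCount G (suc t) (U ─ b) + when (U b) (cliqueCount G t (U ∩ adj G b))
  ≡⟨ sym (cliqueCount-split G b t U) ⟩
    cliqueCount G (suc t) U
  ≡⟨ none ⟩
    0
  ∎)
  where open ≡-Reasoning

outside-empty⇒≗∩ : ∀ (U K : VertexSet n) → card (U ∩ ∁ K) ≡ 0 → U ≗ U ∩ K
outside-empty⇒≗∩ U K ∣U∖K∣≡0 i with U i | K i | card-zero (U ∩ ∁ K) ∣U∖K∣≡0 i
... | true  | true  | _  = refl
... | true  | false | ()
... | false | _     | _  = refl

∩-remove-outside : ∀ (U K : VertexSet n) b → K b ≡ false → (U ─ b) ∩ K ≗ U ∩ K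
∩-remove-outside U K b b∉K i with i Fin.≟ b
... | yes refl rewrite b∉K = trans (Bool.∧-zeroʳ _) (sym (Bool.∧-zeroʳ _))
... | no _     = cong (_∧ K i) (Bool.∧-identityʳ (U i))

card-remove-outside : ∀ (U K : VertexSet n) b {s} → (U ∩ ∁ K) b ≡ true →
  card (U ∩ ∁ K) ≡ suc s → card ((U ─ b) ∩ ∁ K) ≡ s
card-remove-outside U K b {s} b∈U∖K ∣U∖K∣≡1+s = suc-injective (begin
  suc (card ((U ─ b) ∩ ∁ K))  ≡⟨ cong suc (card-cong (λ i → ∧-swapʳ (U i) _ _)) ⟩
  suc (card (U ∩ ∁ K ─ b))    ≡⟨ card-remove (U ∩ ∁ K) b b∈U∖K ⟨
  card (U ∩ ∁ K)              ≡⟨ ∣U∖K∣≡1+s ⟩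
  suc s                       ∎)
  where open ≡-Reasoning

∈-∩∁⇒∉ : ∀ (U K : VertexSet n) b → (U ∩ ∁ K) b ≡ true → K b ≡ false
∈-∩∁⇒∉ U K b b∈U∖K = trans (sym (Bool.not-involutive (K b))) (cong not (Bool.∧-conicalʳ _ _ b∈U∖K))

cliqueCount-peel : ∀ (G : Graph n) t M K s U →
  card (U ∩ ∁ K) ≡ s →
  (∀ b → U b ≡ true → cliqueCount G t (U ∩ adj G b) ≤ M) →
  cliqueCount G (suc t) U ≤ cliqueCount G (suc t) (U ∩ K) + s * M
cliqueCount-peel G t M K zero U ∣U∖K∣≡0 bound =
  ≤-trans (≤-reflexive (cliqueCount-cong G (suc t) (outside-empty⇒≗∩ U K ∣U∖K∣≡0))) (m≤m+n _ _)
cliqueCount-peel G t M K (suc s) U ∣U∖K∣≡1+s bound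
  with b , b∈U∖K ← card-nonempty (U ∩ ∁ K) ∣U∖K∣≡1+s = begin
    cliqueCount G (suc t) U
  ≡⟨ cliqueCount-split G b t U ⟩
    cliqueCount G (suc t) (U ─ b) + when (U b) (cliqueCount G t (U ∩ adj G b))
  ≡⟨ cong (λ x → cliqueCount G (suc t) (U ─ b) + when x (cliqueCount G t (U ∩ adj G b))) b∈U ⟩
    cliqueCount G (suc t) (U ─ b) + cliqueCount G t (U ∩ adj G b)
  ≤⟨ +-mono-≤ (cliqueCount-peel G t M K s (U ─ b) (card-remove-outside U K b b∈U∖K ∣U∖K∣≡1+s) bound′)
              (bound b b∈U) ⟩
    (cliqueCount G (suc t) ((U ─ b) ∩ K) + s * M) + M
  ≡⟨ cong (λ x → x + s * M + M) (cliqueCount-cong G (suc t) (∩-remove-outside U K b (∈-∩∁⇒∉ U K b b∈U∖K))) ⟩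
    (cliqueCount G (suc t) (U ∩ K) + s * M) + M
  ≡⟨ trans (+-assoc _ (s * M) M) (cong (cliqueCount G (suc t) (U ∩ K) +_) (+-comm (s * M) M)) ⟩
    cliqueCount G (suc t) (U ∩ K) + suc s * M
  ∎
  where
    open ≤-Reasoning
    b∈U : U b ≡ true
    b∈U = Bool.∧-conicalˡ _ _ b∈U∖K
    bound′ : ∀ c → (U ─ b) c ≡ true → cliqueCount G t ((U ─ b) ∩ adj G c) ≤ M
    bound′ c c∈U─b = ≤-trans
      (cliqueCount-mono G t (∩-monoˡ (adj G c) (λ i → Bool.∧-conicalˡ _ _)))
      (bound c (Bool.∧-conicalˡ _ _ c∈U─b))

-- U ∖ K is independent and fully joined to U ∩ K, so a clique meets it in at most one vertex.
cliqueCount-independent : ∀ (G : Graph n) t K s U →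
  card (U ∩ ∁ K) ≡ s →
  (∀ b → U b ≡ true → K b ≡ false → U ∩ adj G b ≗ U ∩ K) →
  cliqueCount G (suc t) U ≡ cliqueCount G (suc t) (U ∩ K) + s * cliqueCount G t (U ∩ K)
cliqueCount-independent G t K zero U ∣U∖K∣≡0 nbhd =
  trans (cliqueCount-cong G (suc t) (outside-empty⇒≗∩ U K ∣U∖K∣≡0)) (sym (+-identityʳ _))
cliqueCount-independent G t K (suc s) U ∣U∖K∣≡1+s nbhd
  with b , b∈U∖K ← card-nonempty (U ∩ ∁ K) ∣U∖K∣≡1+s = begin
    cliqueCount G (suc t) U
  ≡⟨ cliqueCount-split G b t U ⟩
    cliqueCount G (suc t) (U ─ b) + when (U b) (cliqueCount G t (U ∩ adj G b))
  ≡⟨ cong₂ (λ x y → cliqueCount G (suc t) (U ─ b) + when x y) b∈U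
           (cliqueCount-cong G t (nbhd b b∈U b∉K)) ⟩
    cliqueCount G (suc t) (U ─ b) + X
  ≡⟨ cong (_+ X) (cliqueCount-independent G t K s (U ─ b)
                    (card-remove-outside U K b b∈U∖K ∣U∖K∣≡1+s) nbhd′) ⟩
    (cliqueCount G (suc t) ((U ─ b) ∩ K) + s * cliqueCount G t ((U ─ b) ∩ K)) + X
  ≡⟨ cong₂ (λ x y → x + s * y + X) (cliqueCount-cong G (suc t) U─b∩K≗U∩K) (cliqueCount-cong G t U─b∩K≗U∩K) ⟩
    (cliqueCount G (suc t) (U ∩ K) + s * X) + X
  ≡⟨ trans (+-assoc _ (s * X) X) (cong (cliqueCount G (suc t) (U ∩ K) +_) (+-comm (s * X) X)) ⟩
    cliqueCount G (suc t) (U ∩ K) + suc s * X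
  ∎
  where
    open ≡-Reasoning
    X = cliqueCount G t (U ∩ K)
    b∈U : U b ≡ true
    b∈U = Bool.∧-conicalˡ _ _ b∈U∖K
    b∉K : K b ≡ false
    b∉K = ∈-∩∁⇒∉ U K b b∈U∖K
    U─b∩K≗U∩K : (U ─ b) ∩ K ≗ U ∩ K
    U─b∩K≗U∩K = ∩-remove-outside U K b b∉K
    nbhd′ : ∀ c → (U ─ b) c ≡ true → K c ≡ false → (U ─ b) ∩ adj G c ≗ (U ─ b) ∩ K
    nbhd′ c c∈U─b c∉K i =
      trans (∧-swapʳ (U i) _ _)
        (trans (cong (_∧ _) (nbhd c (Bool.∧-conicalˡ _ _ c∈U─b) c∉K i)) (∧-swapʳ (U i) _ _))

stepwise : ∀ {ℓ} (R : ℕ → ℕ → Set ℓ) → Reflexive R → Transitive R → ∀ {x y} →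
  (∀ z → x ≤ z → z < y → R z (suc z)) → x ≤ y → R x y
stepwise R R-refl R-trans step x≤y = go (≤⇒≤′ x≤y) step
  where
    go : ∀ {x y} → x ≤′ y → (∀ z → x ≤ z → z < y → R z (suc z)) → R x y
    go (≤′-reflexive refl) step = R-refl
    go (≤′-step x≤′y)      step =
      R-trans (go x≤′y (λ z x≤z z<y → step z x≤z (m<n⇒m<1+n z<y))) (step _ (≤′⇒≤ x≤′y) ≤-refl)

unimodal-max : ∀ (g : ℕ → ℕ) p n →
  (∀ x → x < p → g x ≤ g (suc x)) → (∀ x → p ≤ x → x < n → g (suc x) ≤ g x) →
  ∀ x → x ≤ n → g x ≤ g p
unimodal-max g p n up down x x≤n with ≤-total x p
... | inj₁ x≤p = stepwise (λ a b → g a ≤ g b) ≤-refl ≤-trans (λ z _ z<p → up z z<p) x≤p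
... | inj₂ p≤x = stepwise (λ a b → g b ≤ g a) ≤-refl (flip ≤-trans)
                   (λ z p≤z z<x → down z p≤z (<-≤-trans z<x x≤n)) p≤x

-- For a list of part sizes, esym t counts the t-cliques of the complete multipartite graph.
esym : ℕ → List ℕ → ℕ
esym zero    xs       = 1
esym (suc t) []       = 0
esym (suc t) (x ∷ xs) = esym (suc t) xs + x * esym t xs

esym-swap : ∀ t x y xs → esym t (x ∷ y ∷ xs) ≡ esym t (y ∷ x ∷ xs)
esym-swap zero          x y xs = refl
esym-swap (suc zero)    x y xs =
  solve 3 (λ a x y → (a :+ y :* con 1) :+ x :* con 1 := (a :+ x :* con 1) :+ y :* con 1)
    refl (esym 1 xs) x y
esym-swap (suc (suc t)) x y xs =
  solve 5 (λ a b c x y → (a :+ y :* b) :+ x :* (b :+ y :* c) := (a :+ x :* b) :+ y :* (b :+ x :* c))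
    refl (esym (suc (suc t)) xs) (esym (suc t) xs) (esym t xs) x y

esym-transfer : ∀ t {a b} xs → a ≤ b → esym t (a ∷ suc b ∷ xs) ≤ esym t (suc a ∷ b ∷ xs)
esym-transfer zero          xs a≤b = ≤-refl
esym-transfer (suc zero) {a} {b} xs a≤b = ≤-reflexive
  (solve 3 (λ E a b → (E :+ (con 1 :+ b) :* con 1) :+ a :* con 1
                   := (E :+ b :* con 1) :+ (con 1 :+ a) :* con 1) refl (esym 1 xs) a b)
esym-transfer (suc (suc t)) {a} {b} xs a≤b = begin
    (A + suc b * B) + a * (B + suc b * C)
  ≡⟨ solve 5 (λ A B C a b → (A :+ (con 1 :+ b) :* B) :+ a :* (B :+ (con 1 :+ b) :* C)
                         := (A :+ (a :+ b) :* B :+ B) :+ (a :* b :+ a) :* C) refl A B C a b ⟩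
    (A + (a + b) * B + B) + (a * b + a) * C
  ≤⟨ +-monoʳ-≤ (A + (a + b) * B + B) (*-monoˡ-≤ C (+-monoʳ-≤ (a * b) a≤b)) ⟩
    (A + (a + b) * B + B) + (a * b + b) * C
  ≡⟨ solve 5 (λ A B C a b → (A :+ (a :+ b) :* B :+ B) :+ (a :* b :+ b) :* C
                         := (A :+ b :* B) :+ (con 1 :+ a) :* (B :+ b :* C)) refl A B C a b ⟩
    (A + b * B) + suc a * (B + b * C)
  ∎
  where
    open ≤-Reasoning
    A = esym (suc (suc t)) xs
    B = esym (suc t) xs
    C = esym t xs

esym-suc≤sum* : ∀ t xs → esym (suc t) xs ≤ sum xs * esym t xs
esym-suc≤sum* t []       = z≤n
esym-suc≤sum* t (x ∷ xs) = begin
    esym (suc t) xs + x * esym t xs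
  ≤⟨ +-monoˡ-≤ (x * esym t xs) (esym-suc≤sum* t xs) ⟩
    sum xs * esym t xs + x * esym t xs
  ≡⟨ solve 3 (λ s x c → s :* c :+ x :* c := (x :+ s) :* c) refl (sum xs) x (esym t xs) ⟩
    (x + sum xs) * esym t xs
  ≤⟨ *-monoʳ-≤ (x + sum xs) (esym-≤-∷ t x xs) ⟩
    (x + sum xs) * esym t (x ∷ xs)
  ∎
  where
    open ≤-Reasoning
    esym-≤-∷ : ∀ t x xs → esym t xs ≤ esym t (x ∷ xs)
    esym-≤-∷ zero    x xs = ≤-refl
    esym-≤-∷ (suc t) x xs = m≤m+n _ _

esym-∷-cong : ∀ {xs ys} → (∀ t → esym t xs ≡ esym t ys) → ∀ x t → esym t (x ∷ xs) ≡ esym t (x ∷ ys)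
esym-∷-cong xs≈ys x zero    = refl
esym-∷-cong xs≈ys x (suc t) = cong₂ (λ u v → u + x * v) (xs≈ys (suc t)) (xs≈ys t)

esym-↭ : ∀ {xs ys} → xs ↭ ys → ∀ t → esym t xs ≡ esym t ys
esym-↭ ↭.refl          t = refl
esym-↭ (prep x p)      t = esym-∷-cong (esym-↭ p) x t
esym-↭ (swap x y p)    t = trans (esym-swap t x y _) (esym-∷-cong (esym-∷-cong (esym-↭ p) x) y t)
esym-↭ (↭.trans p q)   t = trans (esym-↭ p t) (esym-↭ q t)

esym-head-mono : ∀ t {a b} xs → a ≤ b → esym t (a ∷ xs) ≤ esym t (b ∷ xs)
esym-head-mono zero    xs a≤b = ≤-refl
esym-head-mono (suc t) xs a≤b = +-monoʳ-≤ (esym (suc t) xs) (*-monoˡ-≤ (esym t xs) a≤b)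

[r+q*m]/m≡q : ∀ m .{{_ : NonZero m}} {q r} → r < m → (r + q * m) / m ≡ q
[r+q*m]/m≡q m {q} {r} r<m =
  trans (+-distrib-/-∣ʳ r (n∣m*n q)) (cong₂ _+_ (m<n⇒m/n≡0 r<m) (m*n/n≡m q m))

[r+q*[1+m]]∸q≡r+q*m : ∀ r q m → r + q * suc m ∸ q ≡ r + q * m
[r+q*[1+m]]∸q≡r+q*m r q m = begin
  r + q * suc m ∸ q     ≡⟨ cong (λ x → r + x ∸ q) (*-suc q m) ⟩
  r + (q + q * m) ∸ q   ≡⟨ cong (_∸ q) (+-swapˡ r q (q * m)) ⟩
  q + (r + q * m) ∸ q   ≡⟨ m+n∸m≡n q _ ⟩
  r + q * m             ∎
  where open ≡-Reasoning

-- The part sizes of the Turán graph T_ω(k).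
balanced : ℕ → ℕ → List ℕ
balanced zero    k = []
balanced (suc w) k = k / suc w ∷ balanced w (k ∸ k / suc w)

sum-balanced : ∀ w k → sum (balanced (suc w) k) ≡ k
sum-balanced zero    k = trans (+-identityʳ (k / 1)) (n/1≡n k)
sum-balanced (suc w) k = trans (cong (k / suc (suc w) +_) (sum-balanced w _))
                               (m+[n∸m]≡n (m/n≤m k (suc (suc w))))

balanced-suc : ∀ w k → ∃ λ rest →
  balanced (suc w) (suc k) ↭ suc (k / suc w) ∷ rest × balanced (suc w) k ↭ k / suc w ∷ rest
balanced-suc zero k =
  [] , ↭.↭-reflexive (cong (_∷ []) (trans (n/1≡n (suc k)) (cong suc (sym (n/1≡n k))))) , ↭.refl
balanced-suc (suc w) k with m≤n⇒m<n∨m≡n (m%n<n k (suc (suc w)))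
... | inj₁ 1+r<m with rest , after , before ← balanced-suc w (k ∸ k / suc (suc w)) =
  ℓ ∷ rest , after′ , prep q before
  where
    m = suc (suc w)
    q = k / m
    ℓ = (k ∸ q) / suc w
    ℓ≡q : ℓ ≡ q
    ℓ≡q = trans (cong (λ x → (x ∸ q) / suc w) (m≡m%n+[m/n]*n k m))
            (trans (cong (_/ suc w) ([r+q*[1+m]]∸q≡r+q*m (k % m) q (suc w)))
              ([r+q*m]/m≡q (suc w) (≤-pred 1+r<m)))
    [1+k]/m≡q : suc k / m ≡ q
    [1+k]/m≡q = trans (cong (_/ m) (cong suc (m≡m%n+[m/n]*n k m))) ([r+q*m]/m≡q m 1+r<m)
    after′ : balanced m (suc k) ↭ suc q ∷ ℓ ∷ rest
    after′ = begin
      balanced m (suc k)                  ≡⟨ cong (λ x → x ∷ balanced (suc w) (suc k ∸ x)) [1+k]/m≡q ⟩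
      q ∷ balanced (suc w) (suc k ∸ q)    ≡⟨ cong (λ x → q ∷ balanced (suc w) x) (+-∸-assoc 1 (m/n≤m k m)) ⟩
      q ∷ balanced (suc w) (suc (k ∸ q))  ↭⟨ prep q after ⟩
      q ∷ suc ℓ ∷ rest                    ↭⟨ swap q (suc ℓ) ↭.refl ⟩
      suc ℓ ∷ q ∷ rest                    ≡⟨ cong₂ (λ x y → suc x ∷ y ∷ rest) ℓ≡q (sym ℓ≡q) ⟩
      suc q ∷ ℓ ∷ rest                    ∎
      where open ↭.PermutationReasoning
... | inj₂ 1+r≡m = balanced (suc w) (k ∸ q) ,
  ↭.↭-reflexive (cong (λ x → x ∷ balanced (suc w) (suc k ∸ x)) [1+k]/m≡1+q) , ↭.refl
  where
    m = suc (suc w)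
    q = k / m
    [1+k]/m≡1+q : suc k / m ≡ suc q
    [1+k]/m≡1+q = trans (cong (λ x → suc x / m) (m≡m%n+[m/n]*n k m))
      (trans (cong (λ x → (x + q * m) / m) 1+r≡m) (m*n/n≡m (suc q) m))

esym-balanced-mono : ∀ ω t {k k′} → k ≤ k′ → esym t (balanced ω k) ≤ esym t (balanced ω k′)
esym-balanced-mono zero    t k≤k′ = ≤-refl
esym-balanced-mono (suc w) t k≤k′ =
  stepwise (λ a b → esym t (balanced (suc w) a) ≤ esym t (balanced (suc w) b)) ≤-refl ≤-trans
    (λ k _ _ → grow k) k≤k′
  where
    grow : ∀ k → esym t (balanced (suc w) k) ≤ esym t (balanced (suc w) (suc k))
    grow k with rest , after , before ← balanced-suc w k = begin
      esym t (balanced (suc w) k)        ≡⟨ esym-↭ before t ⟩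
      esym t (k / suc w ∷ rest)          ≤⟨ esym-head-mono t rest (n≤1+n _) ⟩
      esym t (suc (k / suc w) ∷ rest)    ≡⟨ esym-↭ after t ⟨
      esym t (balanced (suc w) (suc k))  ∎
      where open ≤-Reasoning

-- x ↦ esym t (x ∷ balanced w (n ∸ x)) increases up to ⌊n/(w+2)⌋ and decreases after it.
esym-balanced-optimal : ∀ w t n x → x ≤ n →
  esym t (x ∷ balanced w (n ∸ x)) ≤ esym t (balanced (suc w) n)
esym-balanced-optimal zero    t n x x≤n =
  esym-head-mono t [] (≤-trans x≤n (≤-reflexive (sym (n/1≡n n))))
esym-balanced-optimal (suc w) t n x x≤n = unimodal-max g (n / m) n up down x x≤n
  where
    m = suc (suc w)
    g : ℕ → ℕ
    g y = esym t (y ∷ balanced (suc w) (n ∸ y))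

    up : ∀ y → y < n / m → g y ≤ g (suc y)
    up y y<p with rest , after , before ← balanced-suc w (n ∸ suc y) = begin
        g y
      ≡⟨ cong (λ z → esym t (y ∷ balanced (suc w) z)) (+-∸-assoc 1 y<n) ⟩
        esym t (y ∷ balanced (suc w) (suc n′))
      ≡⟨ esym-↭ (prep y after) t ⟩
        esym t (y ∷ suc ℓ ∷ rest)
      ≤⟨ esym-transfer t rest y≤ℓ ⟩
        esym t (suc y ∷ ℓ ∷ rest)
      ≡⟨ esym-↭ (prep (suc y) before) t ⟨
        g (suc y)
      ∎
      where
        open ≤-Reasoning
        n′ = n ∸ suc y
        ℓ = n′ / suc w
        [1+y]*m≤n : suc y * m ≤ n
        [1+y]*m≤n = ≤-trans (*-monoˡ-≤ m y<p) (m/n*n≤m n m)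
        y<n : y < n
        y<n = ≤-trans (m≤m+n (suc y) _) (≤-trans (≤-reflexive (sym (*-suc (suc y) (suc w)))) [1+y]*m≤n)
        y≤ℓ : y ≤ ℓ
        y≤ℓ = <⇒≤ (begin-strict
          y                              <⟨ n<1+n y ⟩
          suc y                          ≡⟨ m*n/n≡m (suc y) (suc w) ⟨
          suc y * suc w / suc w          ≤⟨ /-monoˡ-≤ (suc w) (m+n≤o⇒m≤o∸n (suc y * suc w)
                                              (≤-trans (≤-reflexive (trans (+-comm _ (suc y))
                                                (sym (*-suc (suc y) (suc w))))) [1+y]*m≤n)) ⟩
          ℓ                              ∎)

    down : ∀ y → n / m ≤ y → y < n → g (suc y) ≤ g y
    down y p≤y y<n with rest , after , before ← balanced-suc w (n ∸ suc y) = begin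
        g (suc y)
      ≡⟨ esym-↭ (prep (suc y) before) t ⟩
        esym t (suc y ∷ ℓ ∷ rest)
      ≡⟨ esym-swap t (suc y) ℓ rest ⟩
        esym t (ℓ ∷ suc y ∷ rest)
      ≤⟨ esym-transfer t rest ℓ≤y ⟩
        esym t (suc ℓ ∷ y ∷ rest)
      ≡⟨ esym-swap t (suc ℓ) y rest ⟩
        esym t (y ∷ suc ℓ ∷ rest)
      ≡⟨ esym-↭ (prep y after) t ⟨
        esym t (y ∷ balanced (suc w) (suc n′))
      ≡⟨ cong (λ z → esym t (y ∷ balanced (suc w) z)) (+-∸-assoc 1 y<n) ⟨
        g y
      ∎
      where
        open ≤-Reasoning
        n′ = n ∸ suc y
        ℓ = n′ / suc w
        n<[1+y]*m : n < suc y + suc y * suc w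
        n<[1+y]*m = begin-strict
          n                          ≡⟨ m≡m%n+[m/n]*n n m ⟩
          n % m + n / m * m          <⟨ +-monoˡ-< (n / m * m) (m%n<n n m) ⟩
          suc (n / m) * m            ≤⟨ *-monoˡ-≤ m (s≤s p≤y) ⟩
          suc y * m                  ≡⟨ *-suc (suc y) (suc w) ⟩
          suc y + suc y * suc w      ∎
        ℓ≤y : ℓ ≤ y
        ℓ≤y = ≤-pred (m<n*o⇒m/o<n (m<n+o⇒m∸n<o n (suc y) n<[1+y]*m))

argmax-in : ∀ (f : Fin n → ℕ) (U : VertexSet n) v₀ → U v₀ ≡ true →
  ∃ λ v → U v ≡ true × (∀ b → U b ≡ true → f b ≤ f v)
argmax-in {n} f U v₀ v₀∈U =
  argmax f v₀ members ,
  argmax-all f v₀∈U (all-filter ∈U? (allFin n)) ,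
  λ b b∈U → All.lookup (f[xs]≤f[argmax] v₀ members) (∈-filter⁺ ∈U? (∈-allFin b) b∈U)
  where
    ∈U? = λ i → U i Bool.≟ true
    members = filter ∈U? (allFin n)

-- Take v of maximum degree d in U. Each vertex of U has a K_(1+w)-free neighbourhood of size at
-- most d, so deleting the s vertices of U outside N(v) loses at most s * esym t (balanced w d)
-- cliques, and what remains lies in the K_(1+w)-free set U ∩ N(v).
zykov : ∀ ω (G : Graph n) t U → cliqueCount G (suc ω) U ≡ 0 →
  cliqueCount G t U ≤ esym t (balanced ω (card U))
zykov ω       G zero    U none = ≤-refl
zykov zero    G (suc t) U none =
  ≤-reflexive (cliqueCount-empty G t (card-zero U (trans (sym (cliqueCount-one G U)) none)))
zykov (suc w) G (suc t) U none with Fin.any? (λ i → U i Bool.≟ true)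
... | no U≡∅ = ≤-trans (≤-reflexive (cliqueCount-empty G t (λ i → Bool.¬-not (λ Ui → U≡∅ (i , Ui))))) z≤n
... | yes (v₀ , v₀∈U) with v , v∈U , maximal ← argmax-in (λ b → card (U ∩ adj G b)) U v₀ v₀∈U = begin
    cliqueCount G (suc t) U
  ≤⟨ cliqueCount-peel G t M N s U refl bound ⟩
    cliqueCount G (suc t) (U ∩ N) + s * M
  ≤⟨ +-monoˡ-≤ (s * M) (zykov w G (suc t) (U ∩ N) (cliqueCount-neighbourhood G (suc w) U v none v∈U)) ⟩
    esym (suc t) (s ∷ balanced w d)
  ≡⟨ cong (λ x → esym (suc t) (s ∷ balanced w x)) ∣U∣∸s≡d ⟨
    esym (suc t) (s ∷ balanced w (card U ∸ s))
  ≤⟨ esym-balanced-optimal w (suc t) (card U) s s≤∣U∣ ⟩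
    esym (suc t) (balanced (suc w) (card U))
  ∎
  where
    open ≤-Reasoning
    N = adj G v
    d = card (U ∩ N)
    s = card (U ∩ ∁ N)
    M = esym t (balanced w d)
    bound : ∀ b → U b ≡ true → cliqueCount G t (U ∩ adj G b) ≤ M
    bound b b∈U = ≤-trans (zykov w G t (U ∩ adj G b) (cliqueCount-neighbourhood G (suc w) U b none b∈U))
                          (esym-balanced-mono w t (maximal b b∈U))
    ∣U∣≡d+s : card U ≡ d + s
    ∣U∣≡d+s = card-split U N
    ∣U∣∸s≡d : card U ∸ s ≡ d
    ∣U∣∸s≡d = trans (cong (_∸ s) ∣U∣≡d+s) (m+n∸n≡m d s)
    s≤∣U∣ : s ≤ card U
    s≤∣U∣ = ≤-trans (m≤n+m s d) (≤-reflexive (sym ∣U∣≡d+s))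

-- Transitivity of x / p ≤ y / q, written with cross products.
cross-trans : ∀ {x y z p q r} .{{_ : NonZero q}} →
  x * q ≤ y * p → y * r ≤ z * q → x * r ≤ z * p
cross-trans {x} {y} {z} {p} {q} {r} xq≤yp yr≤zq = *-cancelˡ-≤ q (begin
  q * (x * r)    ≡⟨ solve 3 (λ q x r → q :* (x :* r) := (x :* q) :* r) refl q x r ⟩
  (x * q) * r    ≤⟨ *-monoˡ-≤ r xq≤yp ⟩
  (y * p) * r    ≡⟨ solve 3 (λ y p r → (y :* p) :* r := p :* (y :* r)) refl y p r ⟩
  p * (y * r)    ≤⟨ *-monoʳ-≤ p yr≤zq ⟩
  p * (z * q)    ≡⟨ solve 3 (λ p z q → p :* (z :* q) := q :* (z :* p)) refl p z q ⟩
  q * (z * p)    ∎)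
  where open ≤-Reasoning

-- Writing balanced (1+w) m ↭ ℓ ∷ rest, this reduces to esym (1+t) rest ≤ sum rest * esym t rest.
esym-balanced-density-step : ∀ w t m →
  esym (suc t) (balanced (suc w) m) * suc m ≤ esym (suc t) (balanced (suc w) (suc m)) * m
esym-balanced-density-step w t m with rest , after , before ← balanced-suc w m = begin
    esym (suc t) (balanced (suc w) m) * suc m
  ≡⟨ cong₂ (λ x y → x * suc y) (esym-↭ before (suc t)) m≡ℓ+S ⟩
    (a + ℓ * c) * suc (ℓ + S)
  ≤⟨ +-cancelʳ-≤ a _ _ (begin
      (a + ℓ * c) * suc (ℓ + S) + a
    ≤⟨ +-monoʳ-≤ ((a + ℓ * c) * suc (ℓ + S)) (esym-suc≤sum* t rest) ⟩
      (a + ℓ * c) * suc (ℓ + S) + S * c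
    ≡⟨ solve 4 (λ ℓ S a c → (a :+ ℓ :* c) :* (con 1 :+ (ℓ :+ S)) :+ S :* c
                         := (a :+ (con 1 :+ ℓ) :* c) :* (ℓ :+ S) :+ a) refl ℓ S a c ⟩
      (a + suc ℓ * c) * (ℓ + S) + a
    ∎) ⟩
    (a + suc ℓ * c) * (ℓ + S)
  ≡⟨ cong₂ _*_ (esym-↭ after (suc t)) m≡ℓ+S ⟨
    esym (suc t) (balanced (suc w) (suc m)) * m
  ∎
  where
    open ≤-Reasoning
    ℓ = m / suc w
    S = sum rest
    a = esym (suc t) rest
    c = esym t rest
    m≡ℓ+S : m ≡ ℓ + S
    m≡ℓ+S = trans (sym (sum-balanced w m)) (sum-↭ before)

esym-balanced-density-mono : ∀ w t {k k′} → 1 ≤ k → k ≤ k′ →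
  esym (suc t) (balanced (suc w) k) * k′ ≤ esym (suc t) (balanced (suc w) k′) * k
esym-balanced-density-mono w t {suc k} {suc k′} _ (s≤s k≤k′) =
  stepwise (λ a b → E (suc a) * suc b ≤ E (suc b) * suc a) ≤-refl
    (λ {a} {b} {c} → cross-trans {E (suc a)} {E (suc b)} {E (suc c)} {suc a} {suc b} {suc c})
    (λ z _ _ → esym-balanced-density-step w t (suc z)) k≤k′
  where
    E : ℕ → ℕ
    E k = esym (suc t) (balanced (suc w) k)

countᵇ : ∀ {A : Set} → (A → Bool) → List A → ℕ
countᵇ p []       = 0
countᵇ p (x ∷ xs) = when (p x) 1 + countᵇ p xs

module _ {A : Set} where

  length-filter≡countᵇ : ∀ (p : A → Bool) xs →
    length (filter (λ x → p x Bool.≟ true) xs) ≡ countᵇ p xs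
  length-filter≡countᵇ p []       = refl
  length-filter≡countᵇ p (x ∷ xs) with p x
  ... | true  = cong suc (length-filter≡countᵇ p xs)
  ... | false = length-filter≡countᵇ p xs

  countᵇ-++ : ∀ (p : A → Bool) xs ys → countᵇ p (xs ++ ys) ≡ countᵇ p xs + countᵇ p ys
  countᵇ-++ p []       ys = refl
  countᵇ-++ p (x ∷ xs) ys =
    trans (cong (when (p x) 1 +_) (countᵇ-++ p xs ys)) (sym (+-assoc (when (p x) 1) _ _))

  countᵇ-map : ∀ {B : Set} (p : B → Bool) (f : A → B) xs →
    countᵇ p (List.map f xs) ≡ countᵇ (λ x → p (f x)) xs
  countᵇ-map p f []       = refl
  countᵇ-map p f (x ∷ xs) = cong (when (p (f x)) 1 +_) (countᵇ-map p f xs)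

  countᵇ-cong : ∀ {p q : A → Bool} → p ≗ q → ∀ xs → countᵇ p xs ≡ countᵇ q xs
  countᵇ-cong p≗q []       = refl
  countᵇ-cong p≗q (x ∷ xs) = cong₂ (λ a b → when a 1 + b) (p≗q x) (countᵇ-cong p≗q xs)

  countᵇ-∧ : ∀ u (p : A → Bool) xs → countᵇ (λ x → u ∧ p x) xs ≡ when u (countᵇ p xs)
  countᵇ-∧ true  p xs       = refl
  countᵇ-∧ false p []       = refl
  countᵇ-∧ false p (x ∷ xs) = countᵇ-∧ false p xs

  countᵇ-nonzero : ∀ (p : A → Bool) xs {c} → countᵇ p xs ≡ suc c → ∃ λ x → p x ≡ true
  countᵇ-nonzero p (x ∷ xs) eq with p x in px
  ... | true  = x , px
  ... | false = countᵇ-nonzero p xs eq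

_⊆ᵇ_ : Subset n → VertexSet n → Bool
[]      ⊆ᵇ U = true
(b ∷ S) ⊆ᵇ U = (not b ∨ head U) ∧ (S ⊆ᵇ tail U)

⊆ᵇ-∩ : ∀ (S : Subset n) U V → S ⊆ᵇ (U ∩ V) ≡ (S ⊆ᵇ U) ∧ (S ⊆ᵇ V)
⊆ᵇ-∩ []          U V = refl
⊆ᵇ-∩ (false ∷ S) U V = ⊆ᵇ-∩ S (tail U) (tail V)
⊆ᵇ-∩ (true  ∷ S) U V with head U | head V
... | true  | true  = ⊆ᵇ-∩ S (tail U) (tail V)
... | true  | false = sym (Bool.∧-zeroʳ _)
... | false | _     = refl

-- A clique test by recursion on the vertices, matching the recursion of allSubsets.
isCliqueRecᵇ : Graph n → Subset n → Bool
isCliqueRecᵇ {zero}  G []      = true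
isCliqueRecᵇ {suc n} G (b ∷ S) = (not b ∨ (S ⊆ᵇ tail (adj G zero))) ∧ isCliqueRecᵇ (dropFirst G) S

cliqueTestᵇ : Graph n → ℕ → VertexSet n → Subset n → Bool
cliqueTestᵇ G t U S = (∣ S ∣ ≡ᵇ t) ∧ (S ⊆ᵇ U) ∧ isCliqueRecᵇ G S

cliqueCount≡countᵇ : ∀ (G : Graph n) t U → cliqueCount G t U ≡ countᵇ (cliqueTestᵇ G t U) (allSubsets n)
cliqueCount≡countᵇ {zero}  G zero    U = refl
cliqueCount≡countᵇ {zero}  G (suc t) U = refl
cliqueCount≡countᵇ {suc n} G t U = begin
    cliqueCount G t U
  ≡⟨ split t ⟩
    countᵇ (λ S → cliqueTestᵇ G t U (true ∷ S)) L + countᵇ (cliqueTestᵇ (dropFirst G) t (tail U)) L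
  ≡⟨ cong₂ _+_ (countᵇ-map (cliqueTestᵇ G t U) (true ∷_) L) (countᵇ-map (cliqueTestᵇ G t U) (false ∷_) L) ⟨
    countᵇ (cliqueTestᵇ G t U) (List.map (true ∷_) L) + countᵇ (cliqueTestᵇ G t U) (List.map (false ∷_) L)
  ≡⟨ countᵇ-++ (cliqueTestᵇ G t U) (List.map (true ∷_) L) _ ⟨
    countᵇ (cliqueTestᵇ G t U) (allSubsets (suc n))
  ∎
  where
    open ≡-Reasoning
    L = allSubsets n
    G′ = dropFirst G
    split : ∀ t → cliqueCount G t U
      ≡ countᵇ (λ S → cliqueTestᵇ G t U (true ∷ S)) L + countᵇ (cliqueTestᵇ G′ t (tail U)) L
    split zero = sym (cong₂ _+_ (countᵇ-∧ false (λ _ → true) L) (sym (cliqueCount≡countᵇ G′ zero (tail U))))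
    split (suc t) = begin
        cliqueCount G′ (suc t) (tail U) + when (head U) (cliqueCount G′ t (tail U ∩ N))
      ≡⟨ +-comm (cliqueCount G′ (suc t) (tail U)) _ ⟩
        when (head U) (cliqueCount G′ t (tail U ∩ N)) + cliqueCount G′ (suc t) (tail U)
      ≡⟨ cong₂ (λ x y → when (head U) x + y) (cliqueCount≡countᵇ G′ t (tail U ∩ N))
                                            (cliqueCount≡countᵇ G′ (suc t) (tail U)) ⟩
        when (head U) (countᵇ (cliqueTestᵇ G′ t (tail U ∩ N)) L) + countᵇ (cliqueTestᵇ G′ (suc t) (tail U)) L
      ≡⟨ cong (_+ countᵇ (cliqueTestᵇ G′ (suc t) (tail U)) L)
              (trans (sym (countᵇ-∧ (head U) _ L)) (countᵇ-cong (test-∷ (head U)) L)) ⟩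
        countᵇ (λ S → cliqueTestᵇ G (suc t) U (true ∷ S)) L + countᵇ (cliqueTestᵇ G′ (suc t) (tail U)) L
      ∎
      where
        N = tail (adj G zero)
        test-∷ : ∀ u S → u ∧ cliqueTestᵇ G′ t (tail U ∩ N) S
                       ≡ (∣ S ∣ ≡ᵇ t) ∧ (u ∧ (S ⊆ᵇ tail U)) ∧ (S ⊆ᵇ N) ∧ isCliqueRecᵇ G′ S
        test-∷ true  S = cong ((∣ S ∣ ≡ᵇ t) ∧_)
          (trans (cong (_∧ isCliqueRecᵇ G′ S) (⊆ᵇ-∩ S (tail U) N)) (Bool.∧-assoc (S ⊆ᵇ tail U) (S ⊆ᵇ N) _))
        test-∷ false S = sym (Bool.∧-zeroʳ _)

IsCliqueSet : Graph n → Subset n → Set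
IsCliqueSet G S = ∀ i j → Vec.lookup S i ≡ true → Vec.lookup S j ≡ true → i ≢ j → adj G i j ≡ true

bool-ext : ∀ {x y} → (x ≡ true → y ≡ true) → (y ≡ true → x ≡ true) → x ≡ y
bool-ext {true}          x⇒y y⇒x = sym (x⇒y refl)
bool-ext {false} {false} x⇒y y⇒x = refl
bool-ext {false} {true}  x⇒y y⇒x = y⇒x refl

module _ {X : Set} (q : X → Bool) where

  all-tabulate⁻ : ∀ {n} (f : Fin n → X) → all q (List.tabulate f) ≡ true → ∀ i → q (f i) ≡ true
  all-tabulate⁻ f h zero    = Bool.∧-conicalˡ _ _ h
  all-tabulate⁻ f h (suc i) = all-tabulate⁻ (λ j → f (suc j)) (Bool.∧-conicalʳ _ _ h) i

  all-tabulate⁺ : ∀ {n} (f : Fin n → X) → (∀ i → q (f i) ≡ true) → all q (List.tabulate f) ≡ true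
  all-tabulate⁺ {zero}  f h = refl
  all-tabulate⁺ {suc n} f h = cong₂ _∧_ (h zero) (all-tabulate⁺ (λ j → f (suc j)) (λ i → h (suc i)))

⊆ᵇ⁻ : ∀ (S : Subset n) U → S ⊆ᵇ U ≡ true → ∀ i → Vec.lookup S i ≡ true → U i ≡ true
⊆ᵇ⁻ (true ∷ S) U h zero    Si = Bool.∧-conicalˡ _ _ h
⊆ᵇ⁻ (b    ∷ S) U h (suc i) Si = ⊆ᵇ⁻ S (tail U) (Bool.∧-conicalʳ _ _ h) i Si

⊆ᵇ⁺ : ∀ (S : Subset n) U → (∀ i → Vec.lookup S i ≡ true → U i ≡ true) → S ⊆ᵇ U ≡ true
⊆ᵇ⁺ []          U h = refl
⊆ᵇ⁺ (true  ∷ S) U h = cong₂ _∧_ (h zero refl) (⊆ᵇ⁺ S (tail U) (λ i → h (suc i)))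
⊆ᵇ⁺ (false ∷ S) U h = ⊆ᵇ⁺ S (tail U) (λ i → h (suc i))

⊆ᵇ-full : ∀ (S : Subset n) → S ⊆ᵇ (λ _ → true) ≡ true
⊆ᵇ-full S = ⊆ᵇ⁺ S _ (λ _ _ → refl)

isCliqueᵇ⁻ : ∀ (G : Graph n) S → isCliqueᵇ G S ≡ true → IsCliqueSet G S
isCliqueᵇ⁻ G S h i j Si Sj i≢j =
  entry (Vec.lookup S i) (Vec.lookup S j) _ (adj G i j) Si Sj (dec-false (i Fin.≟ j) i≢j)
    (all-tabulate⁻ _ _ (all-tabulate⁻ _ _ h i) j)
  where
    entry : ∀ a b d x → a ≡ true → b ≡ true → d ≡ false → (not (a ∧ b ∧ not d) ∨ x) ≡ true → x ≡ true
    entry .true .true .false x refl refl refl x≡true = x≡true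

isCliqueᵇ⁺ : ∀ (G : Graph n) S → IsCliqueSet G S → isCliqueᵇ G S ≡ true
isCliqueᵇ⁺ G S h = all-tabulate⁺ _ _ (λ i → all-tabulate⁺ _ _ (λ j → entry i j))
  where
    entry : ∀ i j → (not (Vec.lookup S i ∧ Vec.lookup S j ∧ not (does (i Fin.≟ j))) ∨ adj G i j) ≡ true
    entry i j with Vec.lookup S i in Si | Vec.lookup S j in Sj | i Fin.≟ j
    ... | false | _     | _       = refl
    ... | true  | false | _       = refl
    ... | true  | true  | yes _   = refl
    ... | true  | true  | no i≢j  = h i j Si Sj i≢j

isCliqueRecᵇ⁻ : ∀ (G : Graph n) S → isCliqueRecᵇ G S ≡ true → IsCliqueSet G S
isCliqueRecᵇ⁻ G (b    ∷ S) h zero    zero    Si Sj i≢j = contradiction refl i≢j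
isCliqueRecᵇ⁻ G (true ∷ S) h zero    (suc j) Si Sj i≢j = ⊆ᵇ⁻ S _ (Bool.∧-conicalˡ _ _ h) j Sj
isCliqueRecᵇ⁻ G (true ∷ S) h (suc i) zero    Si Sj i≢j =
  trans (adj-sym G (suc i) zero) (⊆ᵇ⁻ S _ (Bool.∧-conicalˡ _ _ h) i Si)
isCliqueRecᵇ⁻ G (b    ∷ S) h (suc i) (suc j) Si Sj i≢j =
  isCliqueRecᵇ⁻ (dropFirst G) S (Bool.∧-conicalʳ _ _ h) i j Si Sj (λ i≡j → i≢j (cong suc i≡j))

isCliqueRecᵇ⁺ : ∀ (G : Graph n) S → IsCliqueSet G S → isCliqueRecᵇ G S ≡ true
isCliqueRecᵇ⁺ G []          h = refl
isCliqueRecᵇ⁺ G (true  ∷ S) h =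
  cong₂ _∧_ (⊆ᵇ⁺ S _ (λ j Sj → h zero (suc j) refl Sj λ ()))
            (isCliqueRecᵇ⁺ (dropFirst G) S
              (λ i j Si Sj i≢j → h (suc i) (suc j) Si Sj (i≢j ∘ Fin.suc-injective)))
isCliqueRecᵇ⁺ G (false ∷ S) h =
  isCliqueRecᵇ⁺ (dropFirst G) S (λ i j Si Sj i≢j → h (suc i) (suc j) Si Sj (i≢j ∘ Fin.suc-injective))

isCliqueᵇ≡isCliqueRecᵇ : ∀ (G : Graph n) S → isCliqueᵇ G S ≡ isCliqueRecᵇ G S
isCliqueᵇ≡isCliqueRecᵇ G S = bool-ext
  (λ h → isCliqueRecᵇ⁺ G S (isCliqueᵇ⁻ G S h)) (λ h → isCliqueᵇ⁺ G S (isCliqueRecᵇ⁻ G S h))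

k≡cliqueCount : ∀ t (G : Graph n) → k t G ≡ cliqueCount G t (λ _ → true)
k≡cliqueCount {n} t G = begin
  k t G                                                 ≡⟨ length-filter≡countᵇ (isKtᵇ G t) L ⟩
  countᵇ (isKtᵇ G t) L                                  ≡⟨ countᵇ-cong same L ⟩
  countᵇ (cliqueTestᵇ G t (λ _ → true)) L               ≡⟨ cliqueCount≡countᵇ G t _ ⟨
  cliqueCount G t (λ _ → true)                          ∎
  where
    open ≡-Reasoning
    L = allSubsets n
    same : ∀ S → isKtᵇ G t S ≡ cliqueTestᵇ G t (λ _ → true) S
    same S = cong ((∣ S ∣ ≡ᵇ t) ∧_)
      (trans (isCliqueᵇ≡isCliqueRecᵇ G S) (cong (_∧ isCliqueRecᵇ G S) (sym (⊆ᵇ-full S))))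

cliqueCount-cliqueFree : ∀ (G : Graph n) ω → CliqueNumberAtMost G ω →
  cliqueCount G (suc ω) (λ _ → true) ≡ 0
cliqueCount-cliqueFree {n} G ω ω-bound with cliqueCount G (suc ω) (λ _ → true) in eq
... | zero  = refl
... | suc c
  with S , S-test ← countᵇ-nonzero _ (allSubsets n) (trans (sym (cliqueCount≡countᵇ G (suc ω) _)) eq) =
  contradiction (ω-bound S S-clique) (<⇒≱ (≤-reflexive (sym ∣S∣≡1+ω)))
  where
    ∣S∣≡1+ω : ∣ S ∣ ≡ suc ω
    ∣S∣≡1+ω = ≡ᵇ⇒≡ ∣ S ∣ (suc ω) (Bool.T-≡ .Equivalence.from (Bool.∧-conicalˡ _ _ S-test))
    S-clique : IsClique G S
    S-clique = trans (isCliqueᵇ≡isCliqueRecᵇ G S)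
                 (Bool.∧-conicalʳ _ _ (Bool.∧-conicalʳ (∣ S ∣ ≡ᵇ suc ω) _ S-test))

when-<-suc : ∀ j r → when (does (j <? r)) 1 + when (does (r ≟ j)) 1 ≡ when (does (j <? suc r)) 1
when-<-suc j r with <-cmp j r
... | tri< j<r _ _
  rewrite dec-true (j <? r) j<r | dec-false (r ≟ j) (>⇒≢ j<r) | dec-true (j <? suc r) (m<n⇒m<1+n j<r) = refl
... | tri≈ j≮r refl _
  rewrite dec-false (j <? j) j≮r | dec-true (j ≟ j) refl | dec-true (j <? suc j) (n<1+n j) = refl
... | tri> j≮r _ r<j
  rewrite dec-false (j <? r) j≮r | dec-false (r ≟ j) (<⇒≢ r<j) | dec-false (j <? suc r) (≤⇒≯ r<j) = refl

countBelow : (ℕ → Bool) → ℕ → ℕ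
countBelow p zero    = 0
countBelow p (suc x) = countBelow p x + when (p x) 1

countBelow-suc : ∀ (p : ℕ → Bool) x → countBelow p (suc x) ≡ when (p 0) 1 + countBelow (λ y → p (suc y)) x
countBelow-suc p zero    = +-comm 0 (when (p 0) 1)
countBelow-suc p (suc x) =
  trans (cong (_+ when (p (suc x)) 1) (countBelow-suc p x)) (+-assoc (when (p 0) 1) _ _)

card-toℕ : ∀ (p : ℕ → Bool) N → card {N} (λ i → p (toℕ i)) ≡ countBelow p N
card-toℕ p zero    = refl
card-toℕ p (suc N) =
  trans (cong (when (p 0) 1 +_) (card-toℕ (λ y → p (suc y)) N)) (sym (countBelow-suc p N))

countBelow-mod : ∀ m .{{_ : NonZero m}} j → j < m → ∀ q r → r ≤ m →
  countBelow (λ x → does (x % m ≟ j)) (r + q * m) ≡ q + when (does (j <? r)) 1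
countBelow-mod m j j<m zero zero r≤m rewrite dec-false (j <? 0) (λ ()) = refl
countBelow-mod m j j<m q (suc r) r<m = begin
    countBelow (λ x → does (x % m ≟ j)) (r + q * m) + when (does ((r + q * m) % m ≟ j)) 1
  ≡⟨ cong₂ (λ x y → x + when (does (y ≟ j)) 1) (countBelow-mod m j j<m q r (<⇒≤ r<m))
           (trans ([m+kn]%n≡m%n r q m) (m<n⇒m%n≡m r<m)) ⟩
    (q + when (does (j <? r)) 1) + when (does (r ≟ j)) 1
  ≡⟨ trans (+-assoc q _ _) (cong (q +_) (when-<-suc j r)) ⟩
    q + when (does (j <? suc r)) 1
  ∎
  where open ≡-Reasoning
countBelow-mod m j j<m (suc q) zero r≤m rewrite dec-false (j <? 0) (λ ()) = begin
    countBelow (λ x → does (x % m ≟ j)) (m + q * m)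
  ≡⟨ countBelow-mod m j j<m q m ≤-refl ⟩
    q + when (does (j <? m)) 1
  ≡⟨ cong (λ b → q + when b 1) (dec-true (j <? m) j<m) ⟩
    q + 1
  ≡⟨ +-comm q 1 ⟩
    suc q
  ≡⟨ +-identityʳ (suc q) ⟨
    suc q + 0
  ∎
  where open ≡-Reasoning

map-downFrom-cong : ∀ {f g : ℕ → ℕ} w → (∀ j → j < w → f j ≡ g j) →
  List.map f (downFrom w) ≡ List.map g (downFrom w)
map-downFrom-cong zero    f≡g = refl
map-downFrom-cong (suc w) f≡g =
  cong₂ _∷_ (f≡g w (n<1+n w)) (map-downFrom-cong w (λ j j<w → f≡g j (m<n⇒m<1+n j<w)))

balanced-exact : ∀ w q r → r ≤ w →
  balanced (suc w) (r + q * suc w) ≡ List.map (λ j → q + when (does (j <? r)) 1) (downFrom (suc w))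
balanced-exact w q r r≤w = cong₂ _∷_ head≡ (begin
    balanced w (r + q * suc w ∸ (r + q * suc w) / suc w)
  ≡⟨ cong (λ x → balanced w (r + q * suc w ∸ x)) [r+q*[1+w]]/[1+w]≡q ⟩
    balanced w (r + q * suc w ∸ q)
  ≡⟨ cong (balanced w) ([r+q*[1+m]]∸q≡r+q*m r q w) ⟩
    balanced w (r + q * w)
  ≡⟨ tail≡ w r≤w ⟩
    List.map (λ j → q + when (does (j <? r)) 1) (downFrom w)
  ∎)
  where
    open ≡-Reasoning
    [r+q*[1+w]]/[1+w]≡q : (r + q * suc w) / suc w ≡ q
    [r+q*[1+w]]/[1+w]≡q = [r+q*m]/m≡q (suc w) (s≤s r≤w)
    head≡ : (r + q * suc w) / suc w ≡ q + when (does (w <? r)) 1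
    head≡ = trans [r+q*[1+w]]/[1+w]≡q
      (sym (trans (cong (λ b → q + when b 1) (dec-false (w <? r) (≤⇒≯ r≤w))) (+-identityʳ q)))
    tail≡ : ∀ w → r ≤ w →
      balanced w (r + q * w) ≡ List.map (λ j → q + when (does (j <? r)) 1) (downFrom w)
    tail≡ zero    _ = refl
    tail≡ (suc w) r≤1+w with m≤n⇒m<n∨m≡n r≤1+w
    ... | inj₁ r<1+w = balanced-exact w q r (≤-pred r<1+w)
    ... | inj₂ refl = trans (balanced-exact w (suc q) zero z≤n)
      (map-downFrom-cong (suc w) λ j j<r → begin
        suc q + when (does (j <? 0)) 1   ≡⟨ cong (λ b → suc q + when b 1) (dec-false (j <? 0) (λ ())) ⟩
        suc q + 0                        ≡⟨ +-identityʳ (suc q) ⟩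
        suc q                            ≡⟨ +-comm 1 q ⟩
        q + 1                            ≡⟨ cong (λ b → q + when b 1) (dec-true (j <? suc w) j<r) ⟨
        q + when (does (j <? suc w)) 1   ∎)

<suc∧≮≡≟ : ∀ c j → does (c <? suc j) ∧ not (does (c <? j)) ≡ does (c ≟ j)
<suc∧≮≡≟ c j with <-cmp c j
... | tri< c<j _ _
  rewrite dec-true (c <? suc j) (m<n⇒m<1+n c<j) | dec-true (c <? j) c<j | dec-false (c ≟ j) (<⇒≢ c<j) = refl
... | tri≈ c≮j refl _
  rewrite dec-true (c <? suc c) (n<1+n c) | dec-false (c <? c) c≮j | dec-true (c ≟ c) refl = refl
... | tri> _ _ j<c
  rewrite dec-false (c <? suc j) (≤⇒≯ j<c) | dec-false (c ≟ j) (>⇒≢ j<c) = refl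

<suc∧<≡< : ∀ c j → does (c <? suc j) ∧ does (c <? j) ≡ does (c <? j)
<suc∧<≡< c j with c <? j
... | yes c<j rewrite dec-true (c <? suc j) (m<n⇒m<1+n c<j) | dec-true (c <? j) c<j = refl
... | no  c≮j rewrite dec-false (c <? j) c≮j = Bool.∧-zeroʳ _

<suc∧≢≡<suc∧< : ∀ c j → does (c <? suc j) ∧ not (does (j ≟ c)) ≡ does (c <? suc j) ∧ does (c <? j)
<suc∧≢≡<suc∧< c j with <-cmp c j
... | tri< c<j _ _
  rewrite dec-true (c <? suc j) (m<n⇒m<1+n c<j) | dec-false (j ≟ c) (>⇒≢ c<j) | dec-true (c <? j) c<j = refl
... | tri≈ c≮j refl _
  rewrite dec-true (c <? suc c) (n<1+n c) | dec-true (c ≟ c) refl | dec-false (c <? c) c≮j = refl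
... | tri> _ _ j<c
  rewrite dec-false (c <? suc j) (≤⇒≯ j<c) = refl

partsBelow : ∀ w N → ℕ → VertexSet N
partsBelow w N j i = does (toℕ i % suc w <? j)

partSize : ∀ w N → ℕ → ℕ
partSize w N j = card {N} (λ i → does (toℕ i % suc w ≟ j))

cliqueCount-Turán : ∀ w N t j →
  cliqueCount (Turán (suc w) N) t (partsBelow w N j) ≡ esym t (List.map (partSize w N) (downFrom j))
cliqueCount-Turán w N zero    j       = refl
cliqueCount-Turán w N (suc t) zero    =
  cliqueCount-empty (Turán (suc w) N) t (λ i → dec-false (toℕ i % suc w <? 0) λ ())
cliqueCount-Turán w N (suc t) (suc j) = begin
    cliqueCount T (suc t) B⁺
  ≡⟨ cliqueCount-independent T t B (partSize w N j) B⁺ (card-cong (λ i → <suc∧≮≡≟ (colour i) j)) nbhd ⟩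
    cliqueCount T (suc t) (B⁺ ∩ B) + partSize w N j * cliqueCount T t (B⁺ ∩ B)
  ≡⟨ cong₂ (λ x y → x + partSize w N j * y) (cliqueCount-cong T (suc t) B⁺∩B≗B) (cliqueCount-cong T t B⁺∩B≗B) ⟩
    cliqueCount T (suc t) B + partSize w N j * cliqueCount T t B
  ≡⟨ cong₂ (λ x y → x + partSize w N j * y) (cliqueCount-Turán w N (suc t) j) (cliqueCount-Turán w N t j) ⟩
    esym (suc t) (List.map (partSize w N) (downFrom (suc j)))
  ∎
  where
    open ≡-Reasoning
    T = Turán (suc w) N
    B⁺ = partsBelow w N (suc j)
    B = partsBelow w N j
    colour : Fin N → ℕ
    colour i = toℕ i % suc w
    B⁺∩B≗B : B⁺ ∩ B ≗ B
    B⁺∩B≗B i = <suc∧<≡< (colour i) j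
    nbhd : ∀ b → B⁺ b ≡ true → B b ≡ false → B⁺ ∩ adj T b ≗ B⁺ ∩ B
    nbhd b b∈B⁺ b∉B i =
      trans (cong (λ c → B⁺ i ∧ not (does (c ≟ colour i))) colour-b≡j) (<suc∧≢≡<suc∧< (colour i) j)
      where
        colour-b≡j : colour b ≡ j
        colour-b≡j = ≡ᵇ⇒≡ (colour b) j (Bool.T-≡ .Equivalence.from
          (trans (sym (<suc∧≮≡≟ (colour b) j)) (cong₂ (λ x y → x ∧ not y) b∈B⁺ b∉B)))

partSizes≡balanced : ∀ w N → List.map (partSize w N) (downFrom (suc w)) ≡ balanced (suc w) N
partSizes≡balanced w N = begin
    List.map (partSize w N) (downFrom m)
  ≡⟨ map-downFrom-cong m (λ j j<m → begin
       partSize w N j                                   ≡⟨ card-toℕ _ N ⟩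
       countBelow (λ x → does (x % m ≟ j)) N            ≡⟨ cong (countBelow _) N≡r+q*m ⟩
       countBelow (λ x → does (x % m ≟ j)) (r + q * m)  ≡⟨ countBelow-mod m j j<m q r (<⇒≤ r<m) ⟩
       q + when (does (j <? r)) 1                       ∎) ⟩
    List.map (λ j → q + when (does (j <? r)) 1) (downFrom m)
  ≡⟨ balanced-exact w q r (≤-pred r<m) ⟨
    balanced m (r + q * m)
  ≡⟨ cong (balanced m) N≡r+q*m ⟨
    balanced m N
  ∎
  where
    open ≡-Reasoning
    m = suc w
    q = N / m
    r = N % m
    N≡r+q*m : N ≡ r + q * m
    N≡r+q*m = m≡m%n+[m/n]*n N m
    r<m : r < m
    r<m = m%n<n N m

k-Turán : ∀ w N t → k t (Turán (suc w) N) ≡ esym t (balanced (suc w) N)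
k-Turán w N t = begin
  k t T                                              ≡⟨ k≡cliqueCount t T ⟩
  cliqueCount T t (λ _ → true)                       ≡⟨ cliqueCount-cong T t everyPart ⟩
  cliqueCount T t (partsBelow w N (suc w))           ≡⟨ cliqueCount-Turán w N t (suc w) ⟩
  esym t (List.map (partSize w N) (downFrom (suc w)))  ≡⟨ cong (esym t) (partSizes≡balanced w N) ⟩
  esym t (balanced (suc w) N)                        ∎
  where
    open ≡-Reasoning
    T = Turán (suc w) N
    everyPart : (λ _ → true) ≗ partsBelow w N (suc w)
    everyPart i = sym (dec-true (toℕ i % suc w <? suc w) (m%n<n (toℕ i) (suc w)))

lemma3p8 : (t Δ ω : ℕ) → 2 ≤ t → 2 ≤ Δ → 2 ≤ ω →
    (n : ℕ) → (G : Graph n) →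
    MaxDegreeAtMost G Δ → CliqueNumberAtMost G ω →
    1 ≤ n → n ≤ Δ + floorDivPred Δ ω →
    k t G * (Δ + floorDivPred Δ ω)
      ≤ k t (Turán ω (Δ + floorDivPred Δ ω)) * n
lemma3p8 (suc t) Δ (suc w) (s≤s _) _ (s≤s _) n G _ ω-bound 1≤n n≤N = begin
    k (suc t) G * N
  ≤⟨ *-monoˡ-≤ N k≤E ⟩
    E n * N
  ≤⟨ esym-balanced-density-mono w t 1≤n n≤N ⟩
    E N * n
  ≡⟨ cong (_* n) (k-Turán w N (suc t)) ⟨
    k (suc t) (Turán (suc w) N) * n
  ∎
  where
    open ≤-Reasoning
    N = Δ + floorDivPred Δ (suc w)
    E : ℕ → ℕ
    E x = esym (suc t) (balanced (suc w) x)
    k≤E : k (suc t) G ≤ E n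
    k≤E = begin
      k (suc t) G                          ≡⟨ k≡cliqueCount (suc t) G ⟩
      cliqueCount G (suc t) (λ _ → true)   ≤⟨ zykov (suc w) G (suc t) _ (cliqueCount-cliqueFree G (suc w) ω-bound) ⟩
      E (card {n} (λ _ → true))            ≡⟨ cong E (card-full {n}) ⟩
      E n                                  ∎
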